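{- Let $n\geq 2$ be even and let $P_n$ be the path with vertices $0,1,\dots,n$ and edges $\{i,i+1\}$ for $0\le i<n$. Then, among all $r\in\{0,\dots,n\}$, the cover cost $cc_r(P_n)$ is minimised when $r$ is an endpoint ($r=0$ or $r=n$) and maximised when $r=n/2$. Moreover, $cc_{n/2}(P_n)-cc_0(P_n)=n/4$.
   Context: Simple random walk on a graph $G=(V,E)$: at each step the walker moves from its current vertex to a uniformly random neighbour. Cover cost: run simple random walk from $r$ until every vertex has been visited. For $i\geq 1$, the cost of the $i$-th step is $1-\frac{k}{n}$, where $k$ is the number of distinct vertices other than $r$ visited at times $0,1,\dots,i-1$, and $n=|V|-1$. The cover cost $cc_r(G)$ is the expected total cost of all steps of this cover tour. -}

module Defs where

open import Data.Nat as ℕ using (ℕ; zero; suc; _≡ᵇ_; _∸_)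
open import Data.Bool using (Bool; _∨_)
open import Data.Fin using (Fin; toℕ; fromℕ<)
open import Data.Fin.Subset using (Subset; ⊤; ⁅_⁆; _∪_; _∩_; ∁; ∣_∣)
open import Data.List using (List; length; filterᵇ; foldr; map; allFin)
open import Data.Integer using (+_)
open import Data.Rational using (ℚ; _/_; _+_; _*_; _-_; 0ℚ; 1ℚ)
open import Data.Product using (Σ; _×_; _,_)
open import Relation.Binary.PropositionalEquality using (_≡_; _≢_)
open import Data.Nat.Properties using (m≤m+n; ≤-trans; n≤1+n)

Graph : ℕ → Set
Graph N = Fin N → List (Fin N)

ℕtoℚ : ℕ → ℚ
ℕtoℚ k = + k / 1

-- k / n as a rational (n = 0 is never used; returns 0 there)
ratio : ℕ → ℕ → ℚ
ratio k zero    = 0ℚ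
ratio k (suc m) = + k / suc m

sumℚ : List ℚ → ℚ
sumℚ = foldr _+_ 0ℚ

-- Cost of a step taken when the set of vertices visited so far is S:
-- 1 - k/n with k = number of visited vertices other than r, n = |V| - 1.
stepCost : ∀ {N} → Fin N → Subset N → ℚ
stepCost {N} r S = 1ℚ - ratio ∣ S ∩ ∁ ⁅ r ⁆ ∣ (N ∸ 1)

-- First-step (Bellman) equations for the expected remaining cover cost
-- E v S of the cover tour from state (current vertex v, visited set S):
--   E v S = 0 if S is the whole vertex set (the tour has ended);
--   otherwise E v S = stepCost r S + (1/deg v) Σ_{w ~ v} E w (S ∪ {w}),
-- written multiplied through by deg v.
IsCoverCostFunction : ∀ {N} → Graph N → Fin N → (Fin N → Subset N → ℚ) → Set
IsCoverCostFunction {N} G r E =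
  (∀ v → E v ⊤ ≡ 0ℚ) ×
  (∀ v S → S ≢ ⊤ →
     ℕtoℚ (length (G v)) * E v S
       ≡ ℕtoℚ (length (G v)) * stepCost r S
         + sumℚ (map (λ w → E w (S ∪ ⁅ w ⁆)) (G v)))

IsCoverCost : ∀ {N} → Graph N → Fin N → ℚ → Set
IsCoverCost G r c =
  Σ (Fin _ → Subset _ → ℚ) λ E → IsCoverCostFunction G r E × E r ⁅ r ⁆ ≡ c

adjᵇ : ℕ → ℕ → Bool
adjᵇ i j = (i ≡ᵇ suc j) ∨ (j ≡ᵇ suc i)

Path : (n : ℕ) → Graph (suc n)
Path n i = filterᵇ (λ j → adjᵇ (toℕ i) (toℕ j)) (allFin (suc n))

v0 : ∀ h → Fin (suc (h ℕ.+ h))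
v0 h = Data.Fin.zero

vmid : ∀ h → Fin (suc (h ℕ.+ h))
vmid h = fromℕ< (ℕ.s≤s (m≤m+n h h))

vend : ∀ h → Fin (suc (h ℕ.+ h))
vend h = Data.Fin.fromℕ (h ℕ.+ h)

-- Step i of the tour costs (#vertices ≠ r not yet visited)/n, so the cover cost is
-- (1/n) Σ_{u ≠ r} H(r,u) with H the expected hitting times. More generally the expected remaining
-- cost from vertex v with visited set S is (1/n) Σ_{u ∉ S ∪ {r}} (time until u is first visited);
-- this solves the first-step equations defining cc, and they have no other solution: the difference
-- of two solutions is, by induction on the number of unvisited vertices, harmonic on S and zero
-- off S, hence zero by the maximum principle on a connected graph. On P_n,
-- H(v,u) = u² - v² for v ≤ u and (v - u)(2n - u - v) for v > u, and summing gives
-- Σ_u H(r,u) = Σ_u H(0,u) + r(n - r), which is least at r ∈ {0, n} and largest at r = n/2,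
-- where it exceeds the endpoint value by (n/2)².

{-# OPTIONS --safe #-}
module Submission where

open import Defs
open import Data.Nat using (ℕ)

module PathHittingTimes where

  open import Data.Bool using (true; false; T; if_then_else_)
  open import Data.Empty using (⊥-elim)
  open import Data.List using (List; []; _∷_; _++_; map; length; applyUpTo)
  open import Data.Nat
  open import Data.Nat.ListAction using (sum)
  open import Data.Nat.ListAction.Properties using (sum-++)
  open import Data.Nat.Properties
  open import Data.Nat.Tactic.RingSolver using (solve)
  open import Data.Product using (_,_)
  open import Data.Sum using (inj₁; inj₂)
  open import Function using (_∘_)
  open import Relation.Binary.Definitions using (tri<; tri≈; tri>)
  open import Relation.Binary.PropositionalEquality
  open import Relation.Nullary using (¬_; contradiction)

  if-T : ∀ {A : Set} {b} {x y : A} → T b → (if b then x else y) ≡ x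
  if-T {b = true} _ = refl

  if-¬T : ∀ {A : Set} {b} {x y : A} → ¬ T b → (if b then x else y) ≡ y
  if-¬T {b = false} _  = refl
  if-¬T {b = true}  ¬t = ⊥-elim (¬t _)

  ≡ᵇ-true⇒≡ : ∀ m n → (m ≡ᵇ n) ≡ true → m ≡ n
  ≡ᵇ-true⇒≡ m n eq = ≡ᵇ⇒≡ m n (subst T (sym eq) _)

  ≡ᵇ-false⇒≢ : ∀ m n → (m ≡ᵇ n) ≡ false → m ≢ n
  ≡ᵇ-false⇒≢ m n eq m≡n = subst T eq (≡⇒≡ᵇ m n m≡n)

  hitting : ℕ → ℕ → ℕ → ℕ
  hitting n v u = if v ≤ᵇ u then (u ∸ v) * (u + v) else (v ∸ u) * ((n ∸ u) + (n ∸ v))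

  hitting-up : ∀ n v u d → u ≡ v + d → hitting n v u ≡ d * (v + d + v)
  hitting-up n v _ d refl = begin
    hitting n v (v + d)       ≡⟨ if-T (≤⇒≤ᵇ (m≤m+n v d)) ⟩
    (v + d ∸ v) * (v + d + v) ≡⟨ cong (_* (v + d + v)) (m+n∸m≡n v d) ⟩
    d * (v + d + v)           ∎
    where open ≡-Reasoning

  hitting-down : ∀ n v u d e → v ≡ u + d → n ≡ v + e → hitting n v u ≡ d * (d + e + e)
  hitting-down _ _ u zero e refl refl = hitting-up (u + 0 + e) (u + 0) u 0 (sym (trans (+-identityʳ (u + 0)) (+-identityʳ u)))
  hitting-down _ _ u (suc d) e refl refl = begin
    hitting n v u                            ≡⟨ if-¬T (λ v≤u → <⇒≱ (m<m+n u z<s) (≤ᵇ⇒≤ v u v≤u)) ⟩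
    (v ∸ u) * ((n ∸ u) + (n ∸ v))            ≡⟨ cong₂ (λ x y → x * (y + (n ∸ v))) (m+n∸m≡n u (suc d)) n∸u ⟩
    suc d * ((suc d + e) + (n ∸ v))          ≡⟨ cong (λ x → suc d * ((suc d + e) + x)) (m+n∸m≡n v e) ⟩
    suc d * (suc d + e + e)                  ∎
    where
    open ≡-Reasoning
    v = u + suc d
    n = v + e
    n∸u : n ∸ u ≡ suc d + e
    n∸u = trans (cong (_∸ u) (+-assoc u (suc d) e)) (m+n∸m≡n u (suc d + e))

  pathNeighbours : ℕ → ℕ → List ℕ
  pathNeighbours n zero    = 1 ∷ []
  pathNeighbours n (suc a) = if suc a ≡ᵇ n then a ∷ [] else a ∷ suc (suc a) ∷ []

  -- Kac's formula: the expected return time to t is 2|E| / deg t.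
  returnTime : ℕ → ℕ → ℕ
  returnTime n zero    = n + n
  returnTime n (suc a) = if suc a ≡ᵇ n then n + n else n

  FirstStep : ℕ → ℕ → ℕ → ℕ → Set
  FirstStep n t u x =
    let ns = pathNeighbours n t in length ns * x ≡ length ns + sum (map (λ j → hitting n j u) ns)

  hitting-firstStep : ∀ n t u → t ≤ n → u ≤ n → u ≢ t → FirstStep n t u (hitting n t u)
  hitting-firstStep n zero zero _ _ u≢t = contradiction refl u≢t
  hitting-firstStep n zero (suc d) _ _ _
    rewrite hitting-up n 0 (suc d) (suc d) refl | hitting-up n 1 (suc d) d refl = solve (d ∷ [])
  hitting-firstStep n (suc a) u t≤n u≤n u≢t with suc a ≡ᵇ n in eq
  ... | true with ≡ᵇ-true⇒≡ (suc a) n eq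
  ...   | refl with m≤n⇒∃[o]m+o≡n (≤-pred (≤∧≢⇒< u≤n u≢t))
  ...     | d , refl
    rewrite hitting-down (suc (u + d)) (suc (u + d)) u (suc d) 0 (sym (+-suc u d)) (sym (+-identityʳ _))
          | hitting-down (suc (u + d)) (u + d) u d 1 refl (+-comm 1 (u + d)) = solve (d ∷ [])
  hitting-firstStep n (suc a) u t≤n u≤n u≢t | false
    with m≤n⇒∃[o]m+o≡n (≤∧≢⇒< t≤n (≡ᵇ-false⇒≢ (suc a) n eq)) | <-cmp u (suc a)
  ... | c , refl | tri< u<t _ _ with m≤n⇒∃[o]m+o≡n (≤-pred u<t)
  ...   | d , refl
    rewrite hitting-down n (suc (u + d)) u (suc d) (suc c) (sym (+-suc u d)) (sym (+-suc (suc (u + d)) c))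
          | hitting-down n (u + d) u d (suc (suc c)) refl (solve (u ∷ d ∷ c ∷ []))
          | hitting-down n (suc (suc (u + d))) u (suc (suc d)) c (solve (u ∷ d ∷ []) ) refl = solve (d ∷ c ∷ [])
  hitting-firstStep n (suc a) u t≤n u≤n u≢t | false | c , refl | tri≈ _ u≡t _ = contradiction u≡t u≢t
  hitting-firstStep n (suc a) u t≤n u≤n u≢t | false | c , refl | tri> _ _ t<u with m≤n⇒∃[o]m+o≡n t<u
  ...   | d , refl
    rewrite hitting-up n (suc a) (suc (suc a) + d) (suc d) (sym (+-suc (suc a) d))
          | hitting-up n a (suc (suc a) + d) (suc (suc d)) (solve (a ∷ d ∷ []))
          | hitting-up n (suc (suc a)) (suc (suc a) + d) d refl = solve (a ∷ d ∷ [])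

  returnTime-firstStep : ∀ n t → 1 ≤ n → t ≤ n → FirstStep n t t (returnTime n t)
  returnTime-firstStep (suc c) zero _ _ rewrite hitting-down (suc c) 1 0 1 c refl refl = solve (c ∷ [])
  returnTime-firstStep n (suc a) _ t≤n with suc a ≡ᵇ n in eq
  ... | true with ≡ᵇ-true⇒≡ (suc a) n eq
  ...   | refl rewrite hitting-up n a (suc a) 1 (+-comm 1 a) = solve (a ∷ [])
  returnTime-firstStep n (suc a) _ t≤n | false with m≤n⇒∃[o]m+o≡n (≤∧≢⇒< t≤n (≡ᵇ-false⇒≢ (suc a) n eq))
  ... | c , refl
    rewrite hitting-up n a (suc a) 1 (+-comm 1 a)
          | hitting-down n (suc (suc a)) (suc a) 1 c (+-comm 1 (suc a)) refl = solve (a ∷ c ∷ [])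

  applyUpTo-++ : ∀ {A : Set} (f : ℕ → A) a b → applyUpTo f (a + b) ≡ applyUpTo f a ++ applyUpTo (f ∘ (a +_)) b
  applyUpTo-++ f zero    b = refl
  applyUpTo-++ f (suc a) b = cong (f 0 ∷_) (applyUpTo-++ (f ∘ suc) a b)

  sum-applyUpTo-shift : ∀ (f g : ℕ → ℕ) c k → (∀ i → i < k → f i ≡ g i + c) →
                        sum (applyUpTo f k) ≡ sum (applyUpTo g k) + k * c
  sum-applyUpTo-shift f g c zero    _  = refl
  sum-applyUpTo-shift f g c (suc k) eq
    rewrite eq 0 z<s | sum-applyUpTo-shift (f ∘ suc) (g ∘ suc) c k (λ i i<k → eq (suc i) (s<s i<k)) =
    +-interchange (g 0) c (sum (applyUpTo (g ∘ suc) k)) (k * c)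
    where
    +-interchange : ∀ a b c d → a + b + (c + d) ≡ a + c + (b + d)
    +-interchange a b c d = solve (a ∷ b ∷ c ∷ d ∷ [])

  totalHitting : ℕ → ℕ → ℕ
  totalHitting n r = sum (applyUpTo (hitting n r) (suc n))

  hitting-suc-below : ∀ n r s i → n ≡ suc r + s → i ≤ r → hitting n (suc r) i ≡ hitting n r i + (2 * s + 1)
  hitting-suc-below n r s i n≡ i≤r with m≤n⇒∃[o]m+o≡n i≤r
  ... | d , refl
    rewrite hitting-down n (suc (i + d)) i (suc d) s (sym (+-suc i d)) n≡
          | hitting-down n (i + d) i d (suc s) refl (trans n≡ (sym (+-suc (i + d) s))) = solve (d ∷ s ∷ [])

  hitting-suc-above : ∀ n r i → hitting n r (suc r + i) ≡ hitting n (suc r) (suc r + i) + (2 * r + 1)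
  hitting-suc-above n r i
    rewrite hitting-up n r (suc r + i) (suc i) (sym (+-suc r i))
          | hitting-up n (suc r) (suc r + i) i refl = solve (r ∷ i ∷ [])

  -- Moving the start from r to r + 1 costs 2s + 1 more for each of the r + 1 targets ≤ r
  -- and saves 2r + 1 for each of the s + 1 targets > r.
  totalHitting-suc : ∀ n r s → n ≡ suc r + s →
                     totalHitting n (suc r) + suc s * (2 * r + 1) ≡ totalHitting n r + suc r * (2 * s + 1)
  totalHitting-suc n r s n≡ = begin
    Tot (suc r) + suc s * (2 * r + 1)
      ≡⟨ cong (_+ suc s * (2 * r + 1)) (split (suc r)) ⟩
    sum (below (suc r)) + sum (above (suc r)) + suc s * (2 * r + 1)
      ≡⟨ cong (λ x → x + sum (above (suc r)) + suc s * (2 * r + 1))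
           (sum-applyUpTo-shift (hitting n (suc r)) (hitting n r) (2 * s + 1) (suc r)
             (λ i i<r → hitting-suc-below n r s i n≡ (≤-pred i<r))) ⟩
    sum (below r) + suc r * (2 * s + 1) + sum (above (suc r)) + suc s * (2 * r + 1)
      ≡⟨ +-rearrange (sum (below r)) (suc r * (2 * s + 1)) (sum (above (suc r))) (suc s * (2 * r + 1)) ⟩
    sum (below r) + (sum (above (suc r)) + suc s * (2 * r + 1)) + suc r * (2 * s + 1)
      ≡⟨ cong (λ x → sum (below r) + x + suc r * (2 * s + 1))
           (sym (sum-applyUpTo-shift (hitting n r ∘ (suc r +_)) (hitting n (suc r) ∘ (suc r +_)) (2 * r + 1) (suc s)
             (λ i _ → hitting-suc-above n r i))) ⟩
    sum (below r) + sum (above r) + suc r * (2 * s + 1)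
      ≡⟨ cong (_+ suc r * (2 * s + 1)) (sym (split r)) ⟩
    Tot r + suc r * (2 * s + 1) ∎
    where
    open ≡-Reasoning
    Tot = totalHitting n
    below above : ℕ → List ℕ
    below t = applyUpTo (hitting n t) (suc r)
    above t = applyUpTo (hitting n t ∘ (suc r +_)) (suc s)
    split : ∀ t → Tot t ≡ sum (below t) + sum (above t)
    split t = begin
      sum (applyUpTo (hitting n t) (suc n))
        ≡⟨ cong (λ k → sum (applyUpTo (hitting n t) k)) (trans (cong suc n≡) (sym (+-suc (suc r) s))) ⟩
      sum (applyUpTo (hitting n t) (suc r + suc s))
        ≡⟨ cong sum (applyUpTo-++ (hitting n t) (suc r) (suc s)) ⟩
      sum (below t ++ above t)
        ≡⟨ sum-++ (below t) (above t) ⟩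
      sum (below t) + sum (above t) ∎
    +-rearrange : ∀ a b c d → a + b + c + d ≡ a + (c + d) + b
    +-rearrange a b c d = solve (a ∷ b ∷ c ∷ d ∷ [])

  totalHitting-formula : ∀ n r s → n ≡ r + s → totalHitting n r ≡ totalHitting n 0 + r * s
  totalHitting-formula n zero    s _  = sym (+-identityʳ (totalHitting n 0))
  totalHitting-formula n (suc r) s n≡ = +-cancelʳ-≡ (suc s * (2 * r + 1)) _ _ (begin
    totalHitting n (suc r) + suc s * (2 * r + 1) ≡⟨ totalHitting-suc n r s n≡ ⟩
    totalHitting n r + suc r * (2 * s + 1)
      ≡⟨ cong (_+ suc r * (2 * s + 1)) (totalHitting-formula n r (suc s) (trans n≡ (sym (+-suc r s)))) ⟩
    T₀ + r * suc s + suc r * (2 * s + 1)         ≡⟨ regroup T₀ r s ⟩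
    T₀ + suc r * s + suc s * (2 * r + 1)         ∎)
    where
    open ≡-Reasoning
    T₀ = totalHitting n 0
    regroup : ∀ t r s → t + r * suc s + suc r * (2 * s + 1) ≡ t + suc r * s + suc s * (2 * r + 1)
    regroup t r s = solve (t ∷ r ∷ s ∷ [])

  *-≤-square-below : ∀ {h r s} → r ≤ h → r + s ≡ h + h → r * s ≤ h * h
  *-≤-square-below {r = r} {s} r≤h eq with m≤n⇒∃[o]m+o≡n r≤h
  ... | d , refl with +-cancelˡ-≡ r s (d + (r + d)) (trans eq (+-assoc r d (r + d)))
  ...   | refl = subst (r * (d + (r + d)) ≤_) (square r d) (m≤m+n _ (d * d))
    where
    square : ∀ r d → r * (d + (r + d)) + d * d ≡ (r + d) * (r + d)
    square r d = solve (r ∷ d ∷ [])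

  *-≤-square : ∀ {h r s} → r + s ≡ h + h → r * s ≤ h * h
  *-≤-square {h} {r} {s} eq with ≤-total r h
  ... | inj₁ r≤h = *-≤-square-below r≤h eq
  ... | inj₂ h≤r = subst (_≤ h * h) (*-comm s r) (*-≤-square-below s≤h (trans (+-comm s r) eq))
    where
    s≤h : s ≤ h
    s≤h = +-cancelˡ-≤ h s h (≤-trans (+-monoˡ-≤ s h≤r) (≤-reflexive eq))

  totalHitting-from-0 : ∀ n t → t ≤ n → totalHitting n t ≡ totalHitting n 0 + t * (n ∸ t)
  totalHitting-from-0 n t t≤n = totalHitting-formula n t (n ∸ t) (sym (m+[n∸m]≡n t≤n))

  totalHitting-min : ∀ n t → t ≤ n → totalHitting n 0 ≤ totalHitting n t
  totalHitting-min n t t≤n = ≤-trans (m≤m+n _ (t * (n ∸ t))) (≤-reflexive (sym (totalHitting-from-0 n t t≤n)))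

  totalHitting-last : ∀ n → totalHitting n n ≡ totalHitting n 0
  totalHitting-last n = trans (totalHitting-formula n n 0 (sym (+-identityʳ n)))
                              (trans (cong (totalHitting n 0 +_) (*-zeroʳ n)) (+-identityʳ (totalHitting n 0)))

  totalHitting-middle : ∀ h → totalHitting (h + h) h ≡ totalHitting (h + h) 0 + h * h
  totalHitting-middle h = totalHitting-formula (h + h) h h refl

  totalHitting-max : ∀ h t → t ≤ h + h → totalHitting (h + h) t ≤ totalHitting (h + h) h
  totalHitting-max h t t≤n = begin
    totalHitting (h + h) t                       ≡⟨ totalHitting-from-0 (h + h) t t≤n ⟩
    totalHitting (h + h) 0 + t * (h + h ∸ t)
      ≤⟨ +-monoʳ-≤ (totalHitting (h + h) 0) (*-≤-square {h} {t} {h + h ∸ t} (m+[n∸m]≡n t≤n)) ⟩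
    totalHitting (h + h) 0 + h * h               ≡⟨ sym (totalHitting-middle h) ⟩
    totalHitting (h + h) h                       ∎
    where open ≤-Reasoning

module RationalArithmetic where

  open import Algebra.Bundles using (CommutativeRing)
  open import Data.Bool using (Bool; true; false)
  open import Data.Fin using (Fin; toℕ)
  open import Data.Fin.Subset using (Subset; ∣_∣)
  open import Data.Integer as ℤ using (+_)
  import Data.Integer.Properties as ℤ
  open import Data.List using (List; []; _∷_; map; length; applyUpTo)
  open import Data.List.Relation.Unary.All using (All; []; _∷_)
  import Data.Nat as ℕ
  open import Data.Nat using (ℕ; zero; suc)
  import Data.Nat.Coprimality as Coprime
  open import Data.Nat.ListAction using (sum)
  import Data.Nat.Properties as ℕ
  open import Data.Rational hiding (∣_∣)
  import Data.Rational.Unnormalised as ℚᵘ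
  open import Data.Rational.Properties
  open import Data.Rational.Solver using (module +-*-Solver)
  open import Data.Nat.Tactic.RingSolver using () renaming (solve-∀ to ℕ-solve-∀)
  open import Data.Vec using (lookup; []; _∷_)
  open import Data.Product using (_×_; _,_; proj₁; proj₂)
  open import Function using (_∘_)
  open import Relation.Binary.PropositionalEquality
  open +-*-Solver
  open import Algebra.Properties.Semiring.Sum (CommutativeRing.semiring +-*-commutativeRing)
    using (sum-syntax; ∑-distrib-+; *-distribˡ-sum; sum-replicate-zero)
    renaming (sum to ∑)

  ℕtoℚ-mkℚ : ∀ k → ℕtoℚ k ≡ mkℚ (+ k) 0 (Coprime.sym (Coprime.1-coprimeTo k))
  ℕtoℚ-mkℚ k = ↥p/↧p≡p (mkℚ (+ k) 0 (Coprime.sym (Coprime.1-coprimeTo k)))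

  ℕtoℚ-suc : ∀ k → ℕtoℚ (suc k) ≡ 1ℚ + ℕtoℚ k
  ℕtoℚ-suc k = begin
    ℕtoℚ (suc k)                  ≡⟨ cong (λ i → (+ 1 ℤ.+ i) / 1) (sym (ℤ.*-identityʳ (+ k))) ⟩
    (+ 1 ℤ.+ + k ℤ.* + 1) / 1     ≡⟨ cong (λ x → 1ℚ + x) (sym (ℕtoℚ-mkℚ k)) ⟩
    1ℚ + ℕtoℚ k                   ∎
    where open ≡-Reasoning

  ℕtoℚ-+ : ∀ a b → ℕtoℚ (a ℕ.+ b) ≡ ℕtoℚ a + ℕtoℚ b
  ℕtoℚ-+ zero    b = sym (+-identityˡ (ℕtoℚ b))
  ℕtoℚ-+ (suc a) b = begin
    ℕtoℚ (suc (a ℕ.+ b))      ≡⟨ ℕtoℚ-suc (a ℕ.+ b) ⟩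
    1ℚ + ℕtoℚ (a ℕ.+ b)       ≡⟨ cong (λ x → 1ℚ + x) (ℕtoℚ-+ a b) ⟩
    1ℚ + (ℕtoℚ a + ℕtoℚ b)    ≡⟨ sym (+-assoc 1ℚ (ℕtoℚ a) (ℕtoℚ b)) ⟩
    1ℚ + ℕtoℚ a + ℕtoℚ b      ≡⟨ cong (_+ ℕtoℚ b) (sym (ℕtoℚ-suc a)) ⟩
    ℕtoℚ (suc a) + ℕtoℚ b     ∎
    where open ≡-Reasoning

  ℕtoℚ-* : ∀ a b → ℕtoℚ (a ℕ.* b) ≡ ℕtoℚ a * ℕtoℚ b
  ℕtoℚ-* zero    b = sym (*-zeroˡ (ℕtoℚ b))
  ℕtoℚ-* (suc a) b = begin
    ℕtoℚ (b ℕ.+ a ℕ.* b)        ≡⟨ ℕtoℚ-+ b (a ℕ.* b) ⟩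
    ℕtoℚ b + ℕtoℚ (a ℕ.* b)     ≡⟨ cong (λ x → ℕtoℚ b + x) (ℕtoℚ-* a b) ⟩
    ℕtoℚ b + ℕtoℚ a * ℕtoℚ b    ≡⟨ solve 2 (λ a b → b :+ a :* b := (con 1ℚ :+ a) :* b) refl (ℕtoℚ a) (ℕtoℚ b) ⟩
    (1ℚ + ℕtoℚ a) * ℕtoℚ b      ≡⟨ cong (_* ℕtoℚ b) (sym (ℕtoℚ-suc a)) ⟩
    ℕtoℚ (suc a) * ℕtoℚ b       ∎
    where open ≡-Reasoning

  ℕtoℚ-mono-≤ : ∀ {a b} → a ℕ.≤ b → ℕtoℚ a ≤ ℕtoℚ b
  ℕtoℚ-mono-≤ {a} a≤b with ℕ.m≤n⇒∃[o]m+o≡n a≤b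
  ... | c , refl = begin
    ℕtoℚ a             ≡⟨ sym (+-identityʳ (ℕtoℚ a)) ⟩
    ℕtoℚ a + 0ℚ        ≤⟨ +-monoʳ-≤ (ℕtoℚ a) (subst (0ℚ ≤_) (sym (ℕtoℚ-mkℚ c)) (nonNegative⁻¹ _)) ⟩
    ℕtoℚ a + ℕtoℚ c    ≡⟨ sym (ℕtoℚ-+ a c) ⟩
    ℕtoℚ (a ℕ.+ c)     ∎
    where open ≤-Reasoning

  ℕtoℚ-suc-* : ∀ k M → M + ℕtoℚ k * M ≡ ℕtoℚ (suc k) * M
  ℕtoℚ-suc-* k M = trans (solve 2 (λ k M → M :+ k :* M := (con 1ℚ :+ k) :* M) refl (ℕtoℚ k) M) (cong (_* M) (sym (ℕtoℚ-suc k)))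

  -- 1 / (m + 1), given in normal form so that products with it compute.
  invSuc : ℕ → ℚ
  invSuc m = mkℚ (+ 1) m (Coprime.1-coprimeTo (suc m))

  ratio-invSuc : ∀ k m → ratio k (suc m) ≡ ℕtoℚ k * invSuc m
  ratio-invSuc k m = sym (begin
    ℕtoℚ k * invSuc m                ≡⟨ cong (_* invSuc m) (ℕtoℚ-mkℚ k) ⟩
    (+ k ℤ.* + 1) / (1 ℕ.* suc m)    ≡⟨ cong₂ (λ i d → i / suc d) (ℤ.*-identityʳ (+ k)) (ℕ.+-identityʳ m) ⟩
    + k / suc m                      ∎)
    where open ≡-Reasoning

  ℕtoℚ-*-invSuc : ∀ m → ℕtoℚ (suc m) * invSuc m ≡ 1ℚ
  ℕtoℚ-*-invSuc m = begin
    ℕtoℚ (suc m) * invSuc m   ≡⟨ sym (ratio-invSuc (suc m) m) ⟩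
    + suc m / suc m
      ≡⟨ fromℚᵘ-cong {ℚᵘ.mkℚᵘ (+ suc m) m} {ℚᵘ.1ℚᵘ} (ℚᵘ.*≡* (ℤ.*-comm (+ suc m) (+ 1))) ⟩
    1ℚ                        ∎
    where open ≡-Reasoning

  invSuc-*-square : ∀ m h → h ℕ.+ h ≡ suc m → invSuc m * ℕtoℚ (h ℕ.* h) ≡ + (h ℕ.+ h) / 4
  invSuc-*-square m h 2h≡n = begin
    i * H²                          ≡⟨ sym (*-identityʳ (i * H²)) ⟩
    i * H² * 1ℚ                     ≡⟨ cong (i * H² *_) (sym (ℕtoℚ-*-invSuc 3)) ⟩
    i * H² * (ℕtoℚ 4 * i₃)
      ≡⟨ solve 4 (λ i a b j → i :* a :* (b :* j) := i :* (a :* b) :* j) refl i H² (ℕtoℚ 4) i₃ ⟩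
    i * (H² * ℕtoℚ 4) * i₃          ≡⟨ cong (λ x → i * x * i₃) square ⟩
    i * (D * D) * i₃                ≡⟨ solve 3 (λ i d j → i :* (d :* d) :* j := (d :* i) :* (d :* j)) refl i D i₃ ⟩
    D * i * (D * i₃)                ≡⟨ cong (_* (D * i₃)) (trans (cong (λ k → ℕtoℚ k * i) 2h≡n) (ℕtoℚ-*-invSuc m)) ⟩
    1ℚ * (D * i₃)                   ≡⟨ *-identityˡ (D * i₃) ⟩
    D * i₃                          ≡⟨ sym (ratio-invSuc (h ℕ.+ h) 3) ⟩
    + (h ℕ.+ h) / 4                 ∎
    where
    open ≡-Reasoning
    i = invSuc m
    i₃ = invSuc 3
    H² = ℕtoℚ (h ℕ.* h)
    D = ℕtoℚ (h ℕ.+ h)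
    four-squares : ∀ h → h ℕ.* h ℕ.* 4 ≡ (h ℕ.+ h) ℕ.* (h ℕ.+ h)
    four-squares = ℕ-solve-∀
    square : H² * ℕtoℚ 4 ≡ D * D
    square = begin
      H² * ℕtoℚ 4                   ≡⟨ sym (ℕtoℚ-* (h ℕ.* h) 4) ⟩
      ℕtoℚ (h ℕ.* h ℕ.* 4)          ≡⟨ cong ℕtoℚ (four-squares h) ⟩
      ℕtoℚ ((h ℕ.+ h) ℕ.* (h ℕ.+ h)) ≡⟨ ℕtoℚ-* (h ℕ.+ h) (h ℕ.+ h) ⟩
      D * D                         ∎

  sumℚ-+ : ∀ {A : Set} (f g : A → ℚ) xs → sumℚ (map (λ x → f x + g x) xs) ≡ sumℚ (map f xs) + sumℚ (map g xs)
  sumℚ-+ f g []       = refl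
  sumℚ-+ f g (x ∷ xs) rewrite sumℚ-+ f g xs =
    solve 4 (λ a b c d → (a :+ b) :+ (c :+ d) := (a :+ c) :+ (b :+ d)) refl (f x) (g x) (sumℚ (map f xs)) (sumℚ (map g xs))

  sumℚ-*ˡ : ∀ {A : Set} a (f : A → ℚ) xs → sumℚ (map (λ x → a * f x) xs) ≡ a * sumℚ (map f xs)
  sumℚ-*ˡ a f []       = sym (*-zeroʳ a)
  sumℚ-*ˡ a f (x ∷ xs) rewrite sumℚ-*ˡ a f xs = sym (*-distribˡ-+ a (f x) (sumℚ (map f xs)))

  sumℚ-neg : ∀ {A : Set} (f : A → ℚ) xs → - sumℚ (map f xs) ≡ sumℚ (map (λ x → - f x) xs)
  sumℚ-neg f []       = refl
  sumℚ-neg f (x ∷ xs) = trans (neg-distrib-+ (f x) (sumℚ (map f xs))) (cong (λ s → - f x + s) (sumℚ-neg f xs))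

  sumℚ-sub : ∀ {A : Set} (f g : A → ℚ) xs → sumℚ (map (λ x → f x - g x) xs) ≡ sumℚ (map f xs) - sumℚ (map g xs)
  sumℚ-sub f g xs = trans (sumℚ-+ f (λ x → - g x) xs) (cong (λ s → sumℚ (map f xs) + s) (sym (sumℚ-neg g xs)))

  sumℚ-zero : ∀ {A : Set} (xs : List A) → sumℚ (map (λ _ → 0ℚ) xs) ≡ 0ℚ
  sumℚ-zero []       = refl
  sumℚ-zero (x ∷ xs) = trans (+-identityˡ _) (sumℚ-zero xs)

  ℕtoℚ-sum : ∀ {A : Set} (f : A → ℕ) xs → ℕtoℚ (sum (map f xs)) ≡ sumℚ (map (ℕtoℚ ∘ f) xs)
  ℕtoℚ-sum f []       = refl
  ℕtoℚ-sum f (x ∷ xs) = trans (ℕtoℚ-+ (f x) (sum (map f xs))) (cong (λ s → ℕtoℚ (f x) + s) (ℕtoℚ-sum f xs))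

  sumℚ-∑-comm : ∀ {A : Set} {k} (F : A → Fin k → ℚ) xs →
                sumℚ (map (λ x → ∑[ u < k ] F x u) xs) ≡ ∑[ u < k ] sumℚ (map (λ x → F x u) xs)
  sumℚ-∑-comm {k = k} F []       = sym (sum-replicate-zero k)
  sumℚ-∑-comm         F (x ∷ xs) = trans (cong (λ s → ∑ (F x) + s) (sumℚ-∑-comm F xs)) (sym (∑-distrib-+ (F x) _))

  +-≤-equality : ∀ {a b c d} → a ≤ c → b ≤ d → a + b ≡ c + d → a ≡ c × b ≡ d
  +-≤-equality {a} {b} {c} {d} a≤c b≤d eq =
    ≤-antisym a≤c (≮⇒≥ λ a<c → <-irrefl eq (+-mono-<-≤ a<c b≤d)) ,
    ≤-antisym b≤d (≮⇒≥ λ b<d → <-irrefl eq (+-mono-≤-< a≤c b<d))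

  sumℚ-≤ : ∀ {A : Set} (f : A → ℚ) M {xs} → All (λ x → f x ≤ M) xs → sumℚ (map f xs) ≤ ℕtoℚ (length xs) * M
  sumℚ-≤ f M []                   = ≤-reflexive (sym (*-zeroˡ M))
  sumℚ-≤ f M {x ∷ xs} (fx≤M ∷ bounded) = begin
    f x + sumℚ (map f xs)               ≤⟨ +-mono-≤ fx≤M (sumℚ-≤ f M bounded) ⟩
    M + ℕtoℚ (length xs) * M            ≡⟨ ℕtoℚ-suc-* (length xs) M ⟩
    ℕtoℚ (suc (length xs)) * M          ∎
    where open ≤-Reasoning

  sumℚ-≡-max : ∀ {A : Set} (f : A → ℚ) M {xs} → All (λ x → f x ≤ M) xs →
               sumℚ (map f xs) ≡ ℕtoℚ (length xs) * M → All (λ x → f x ≡ M) xs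
  sumℚ-≡-max f M []                     _  = []
  sumℚ-≡-max f M {x ∷ xs} (fx≤M ∷ bounded) eq =
    proj₁ split ∷ sumℚ-≡-max f M bounded (proj₂ split)
    where
    split = +-≤-equality fx≤M (sumℚ-≤ f M bounded) (trans eq (sym (ℕtoℚ-suc-* (length xs) M)))

  indicator : Bool → ℚ
  indicator true  = 1ℚ
  indicator false = 0ℚ

  ∑-indicator : ∀ {k} (p : Subset k) → ∑[ u < k ] indicator (lookup p u) ≡ ℕtoℚ ∣ p ∣
  ∑-indicator []          = refl
  ∑-indicator (true ∷ p)  = trans (cong (λ s → 1ℚ + s) (∑-indicator p)) (sym (ℕtoℚ-suc ∣ p ∣))
  ∑-indicator (false ∷ p) = trans (+-identityˡ _) (∑-indicator p)

  ∑-one : ∀ k → ∑[ u < k ] 1ℚ ≡ ℕtoℚ k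
  ∑-one zero    = refl
  ∑-one (suc k) = trans (cong (λ s → 1ℚ + s) (∑-one k)) (sym (ℕtoℚ-suc k))

  ∑-ℕtoℚ : ∀ k (f : ℕ → ℕ) → ∑[ u < k ] ℕtoℚ (f (toℕ u)) ≡ ℕtoℚ (sum (applyUpTo f k))
  ∑-ℕtoℚ zero    f = refl
  ∑-ℕtoℚ (suc k) f = trans (cong (λ s → ℕtoℚ (f 0) + s) (∑-ℕtoℚ k (f ∘ suc))) (sym (ℕtoℚ-+ (f 0) _))

  ∑-*ˡ : ∀ {k} a (f : Fin k → ℚ) → ∑[ u < k ] (a * f u) ≡ a * ∑ f
  ∑-*ˡ a f = sym (*-distribˡ-sum a f)

  *-cancel-ℕtoℚ-suc : ∀ k {q} → ℕtoℚ (suc k) * q ≡ 0ℚ → q ≡ 0ℚ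
  *-cancel-ℕtoℚ-suc k {q} eq = begin
    q                              ≡⟨ sym (*-identityˡ q) ⟩
    1ℚ * q                         ≡⟨ cong (_* q) (sym (trans (*-comm (invSuc k) (ℕtoℚ (suc k))) (ℕtoℚ-*-invSuc k))) ⟩
    invSuc k * ℕtoℚ (suc k) * q    ≡⟨ *-assoc (invSuc k) (ℕtoℚ (suc k)) q ⟩
    invSuc k * (ℕtoℚ (suc k) * q)  ≡⟨ cong (invSuc k *_) eq ⟩
    invSuc k * 0ℚ                  ≡⟨ *-zeroʳ (invSuc k) ⟩
    0ℚ                             ∎
    where open ≡-Reasoning

module HarmonicFunctions where

  open RationalArithmetic
  open import Data.Bool using (true; false)
  open import Data.Empty using (⊥; ⊥-elim)
  open import Data.Fin using (Fin)
  open import Data.Fin.Subset using (Subset)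
  open import Data.List using (map; length; allFin)
  open import Data.List.Membership.Propositional using (_∈_)
  open import Data.List.Membership.Propositional.Properties using (∈-allFin)
  import Data.List.Relation.Unary.All as All
  open import Data.Rational hiding (∣_∣)
  open import Data.Rational.Properties
  open import Data.Vec using (lookup)
  open import Relation.Binary.Bundles using (DecTotalOrder)
  open import Data.List.Extrema (DecTotalOrder.totalOrder ≤-decTotalOrder) using (argmax; f[xs]≤f[argmax])
  open import Relation.Binary.PropositionalEquality
  open import Relation.Nullary using (yes; no)
  open import Algebra.Properties.Group +-0-group using (⁻¹-involutive)

  degree : ∀ {N} → Graph N → Fin N → ℚ
  degree G v = ℕtoℚ (length (G v))

  Connected : ∀ {N} → Graph N → Set₁
  Connected {N} G = (P : Fin N → Set) → (∀ {v w} → w ∈ G v → P v → P w) → ∀ {v w} → P v → P w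

  record HarmonicOn {N} (G : Graph N) (S : Subset N) (f : Fin N → ℚ) : Set where
    field
      vanishes   : ∀ v → lookup S v ≡ false → f v ≡ 0ℚ
      mean-value : ∀ v → lookup S v ≡ true → degree G v * f v ≡ sumℚ (map f (G v))

  HarmonicOn-neg : ∀ {N} {G : Graph N} {S f} → HarmonicOn G S f → HarmonicOn G S (λ v → - f v)
  HarmonicOn-neg {G = G} {f = f} h = record
    { vanishes   = λ v v∉S → cong -_ (vanishes v v∉S)
    ; mean-value = λ v v∈S → trans (sym (neg-distribʳ-* (degree G v) (f v)))
                                   (trans (cong -_ (mean-value v v∈S)) (sumℚ-neg f (G v)))
    }
    where open HarmonicOn h

  module _ {N} {G : Graph N} (connected : Connected G) (S : Subset N) {u : Fin N} (u∉S : lookup S u ≡ false) where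

    module Maximum {f} (h : HarmonicOn G S f) where

      open HarmonicOn h

      M : ℚ
      M = f (argmax f u (allFin N))

      bounded : ∀ v → f v ≤ M
      bounded v = All.lookup (f[xs]≤f[argmax] u (allFin N)) (∈-allFin v)

      module _ (0<M : 0ℚ < M) where

        inside : ∀ {v} → f v ≡ M → lookup S v ≡ true
        inside {v} fv≡M with lookup S v in eq
        ... | true  = refl
        ... | false = ⊥-elim (<-irrefl (trans (sym (vanishes v eq)) fv≡M) 0<M)

        spread : ∀ {v w} → w ∈ G v → f v ≡ M → f w ≡ M
        spread {v} w∈ fv≡M = All.lookup (sumℚ-≡-max f M (All.tabulate λ {w} _ → bounded w) balance) w∈
          where
          balance : sumℚ (map f (G v)) ≡ degree G v * M
          balance = trans (sym (mean-value v (inside fv≡M))) (cong (degree G v *_) fv≡M)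

        -- u is reached from a maximiser, yet f u = 0 < M
        positive-max-absurd : ⊥
        positive-max-absurd = <-irrefl (trans (sym (vanishes u u∉S)) (connected (λ x → f x ≡ M) spread refl)) 0<M

    maximum-principle : ∀ {f} → HarmonicOn G S f → ∀ v → f v ≤ 0ℚ
    maximum-principle h v with Maximum.M h ≤? 0ℚ
    ... | yes M≤0 = ≤-trans (Maximum.bounded h v) M≤0
    ... | no  M≰0 = ⊥-elim (Maximum.positive-max-absurd h (≰⇒> M≰0))

    harmonic-vanishes : ∀ {f} → HarmonicOn G S f → ∀ v → f v ≡ 0ℚ
    harmonic-vanishes h v = ≤-antisym (maximum-principle h v) (neg-≤-0 (maximum-principle (HarmonicOn-neg h) v))
      where
      neg-≤-0 : ∀ {q} → - q ≤ 0ℚ → 0ℚ ≤ q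
      neg-≤-0 {q} -q≤0 = subst (0ℚ ≤_) (⁻¹-involutive q) (neg-antimono-≤ -q≤0)

module SubsetLemmas where

  open import Data.Bool using (true; false)
  open import Data.Bool.Properties using (∨-identityʳ)
  open import Data.Empty using (⊥-elim)
  open import Data.Fin using (Fin; zero; suc)
  open import Data.Fin.Subset using (Subset; ⊤; ⁅_⁆; _∪_; ∁; ∣_∣)
  open import Data.Fin.Subset.Properties using (∪-identityʳ)
  open import Data.Nat using (s≤s; _<_)
  open import Data.Nat.Properties using (≤-reflexive)
  open import Data.Product using (∃-syntax; _,_)
  open import Data.Sum using (_⊎_; inj₁; inj₂)
  open import Data.Vec using (lookup; _∷_; [])
  open import Data.Vec.Properties using (lookup-replicate)
  open import Function using (_∘_)
  open import Relation.Binary.PropositionalEquality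

  full-or-missing : ∀ {k} (S : Subset k) → S ≡ ⊤ ⊎ ∃[ u ] lookup S u ≡ false
  full-or-missing []          = inj₁ refl
  full-or-missing (false ∷ S) = inj₂ (zero , refl)
  full-or-missing (true ∷ S) with full-or-missing S
  ... | inj₁ S≡⊤       = inj₁ (cong (true ∷_) S≡⊤)
  ... | inj₂ (u , u∉S) = inj₂ (suc u , u∉S)

  ∪-⁅⁆-absorb : ∀ {k} (S : Subset k) w → lookup S w ≡ true → S ∪ ⁅ w ⁆ ≡ S
  ∪-⁅⁆-absorb (x ∷ S) zero    refl = cong (true ∷_) (∪-identityʳ S)
  ∪-⁅⁆-absorb (x ∷ S) (suc w) w∈S  = cong₂ _∷_ (∨-identityʳ x) (∪-⁅⁆-absorb S w w∈S)

  ∣∁∣-∪-⁅⁆ : ∀ {k} (S : Subset k) w → lookup S w ≡ false → ∣ ∁ (S ∪ ⁅ w ⁆) ∣ < ∣ ∁ S ∣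
  ∣∁∣-∪-⁅⁆ (false ∷ S) zero    refl = s≤s (≤-reflexive (cong (λ T → ∣ ∁ T ∣) (∪-identityʳ S)))
  ∣∁∣-∪-⁅⁆ (true  ∷ S) (suc w) w∉S  = ∣∁∣-∪-⁅⁆ S w w∉S
  ∣∁∣-∪-⁅⁆ (false ∷ S) (suc w) w∉S  = s≤s (∣∁∣-∪-⁅⁆ S w w∉S)

  lookup-⁅⁆-self : ∀ {k} (w : Fin k) → lookup ⁅ w ⁆ w ≡ true
  lookup-⁅⁆-self zero    = refl
  lookup-⁅⁆-self (suc w) = lookup-⁅⁆-self w

  lookup-⁅⁆-other : ∀ {k} (w u : Fin k) → u ≢ w → lookup ⁅ w ⁆ u ≡ false
  lookup-⁅⁆-other zero    zero    u≢w = ⊥-elim (u≢w refl)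
  lookup-⁅⁆-other zero    (suc u) _   = lookup-replicate u false
  lookup-⁅⁆-other (suc w) zero    _   = refl
  lookup-⁅⁆-other (suc w) (suc u) u≢w = lookup-⁅⁆-other w u (u≢w ∘ cong suc)

module CoverCostUniqueness where

  open RationalArithmetic
  open HarmonicFunctions
  open SubsetLemmas
  open import Data.Bool using (true; false; if_then_else_)
  open import Data.Fin using (Fin)
  open import Data.Fin.Subset using (Subset; ⊤; ⁅_⁆; _∪_; ∁; ∣_∣)
  open import Data.List using (List; _∷_; map; length)
  open import Data.List.Properties using (map-cong)
  open import Data.List.Membership.Propositional using (_∈_)
  open import Data.Nat using (_<_)
  open import Data.Nat.Induction using (<-rec)
  open import Data.Product using (∃-syntax; _,_; proj₁; proj₂)
  open import Data.Rational hiding (∣_∣; _<_)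
  open import Data.Rational.Properties
  open import Data.Rational.Solver using (module +-*-Solver)
  open import Data.Sum using (inj₁; inj₂)
  open import Data.Vec using (lookup)
  open import Data.Vec.Properties using (lookup-replicate)
  open import Relation.Binary.PropositionalEquality
  open +-*-Solver
  open import Algebra.Properties.Group +-0-group using (x∙y⁻¹≈ε⇒x≈y)

  *-cancel-degree : ∀ {A : Set} {xs : List A} {x q} → x ∈ xs → ℕtoℚ (length xs) * q ≡ 0ℚ → q ≡ 0ℚ
  *-cancel-degree {xs = _ ∷ xs} _ = *-cancel-ℕtoℚ-suc (length xs)

  module _ {N} {G : Graph N} (connected : Connected G) (has-neighbour : ∀ v → ∃[ w ] w ∈ G v)
           {r : Fin N} {E E′ : Fin N → Subset N → ℚ}
           (isE : IsCoverCostFunction G r E) (isE′ : IsCoverCostFunction G r E′) where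

    D : Fin N → Subset N → ℚ
    D v S = E v S - E′ v S

    -- Given D = 0 on all larger visited sets, D(·, S) is harmonic on S and vanishes off S.
    module Step (S : Subset N) (IH : ∀ S′ → ∣ ∁ S′ ∣ < ∣ ∁ S ∣ → ∀ v → D v S′ ≡ 0ℚ)
                {u : Fin N} (u∉S : lookup S u ≡ false) where

      S≢⊤ : S ≢ ⊤
      S≢⊤ S≡⊤ with trans (sym u∉S) (trans (cong (λ T → lookup T u) S≡⊤) (lookup-replicate u true))
      ... | ()

      f : Fin N → ℚ
      f w = if lookup S w then D w S else 0ℚ

      f-inside : ∀ {v} → lookup S v ≡ true → f v ≡ D v S
      f-inside {v} v∈S = cong (if_then D v S else 0ℚ) v∈S

      D-∪ : ∀ w → D w (S ∪ ⁅ w ⁆) ≡ f w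
      D-∪ w with lookup S w in eq
      ... | true  = cong (D w) (∪-⁅⁆-absorb S w eq)
      ... | false = IH (S ∪ ⁅ w ⁆) (∣∁∣-∪-⁅⁆ S w eq) w

      D-firstStep : ∀ v → degree G v * D v S ≡ sumℚ (map f (G v))
      D-firstStep v = begin
        d * (E v S - E′ v S)                  ≡⟨ solve 3 (λ d x y → d :* (x :- y) := d :* x :- d :* y) refl d (E v S) (E′ v S) ⟩
        d * E v S - d * E′ v S                ≡⟨ cong₂ _-_ (proj₂ isE v S S≢⊤) (proj₂ isE′ v S S≢⊤) ⟩
        (d * c + ΣE) - (d * c + ΣE′)          ≡⟨ solve 3 (λ c x y → (c :+ x) :- (c :+ y) := x :- y) refl (d * c) ΣE ΣE′ ⟩
        ΣE - ΣE′
          ≡⟨ sym (sumℚ-sub (λ w → E w (S ∪ ⁅ w ⁆)) (λ w → E′ w (S ∪ ⁅ w ⁆)) (G v)) ⟩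
        sumℚ (map (λ w → D w (S ∪ ⁅ w ⁆)) (G v)) ≡⟨ cong sumℚ (map-cong D-∪ (G v)) ⟩
        sumℚ (map f (G v))                    ∎
        where
        open ≡-Reasoning
        d = degree G v
        c = stepCost r S
        ΣE = sumℚ (map (λ w → E w (S ∪ ⁅ w ⁆)) (G v))
        ΣE′ = sumℚ (map (λ w → E′ w (S ∪ ⁅ w ⁆)) (G v))

      f-harmonic : HarmonicOn G S f
      f-harmonic = record
        { vanishes   = λ v v∉S → cong (if_then D v S else 0ℚ) v∉S
        ; mean-value = λ v v∈S → trans (cong (degree G v *_) (f-inside v∈S)) (D-firstStep v)
        }

      f-zero : ∀ v → f v ≡ 0ℚ
      f-zero = harmonic-vanishes connected S u∉S f-harmonic

      D-zero-here : ∀ v → D v S ≡ 0ℚ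
      D-zero-here v with lookup S v in eq
      ... | true  = trans (sym (f-inside eq)) (f-zero v)
      ... | false = *-cancel-degree (proj₂ (has-neighbour v))
                      (trans (D-firstStep v) (trans (cong sumℚ (map-cong f-zero (G v))) (sumℚ-zero (G v))))

    D-zero : ∀ S v → D v S ≡ 0ℚ
    D-zero S = <-rec (λ k → ∀ S → ∣ ∁ S ∣ ≡ k → ∀ v → D v S ≡ 0ℚ) step _ S refl
      where
      step : ∀ k → (∀ {j} → j < k → ∀ S → ∣ ∁ S ∣ ≡ j → ∀ v → D v S ≡ 0ℚ) →
             ∀ S → ∣ ∁ S ∣ ≡ k → ∀ v → D v S ≡ 0ℚ
      step _ IH S refl with full-or-missing S
      ... | inj₁ refl      = λ v → cong₂ _-_ (proj₁ isE v) (proj₁ isE′ v)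
      ... | inj₂ (u , u∉S) = Step.D-zero-here S (λ S′ lt → IH lt S′ refl) u∉S

    coverCostFunction-unique : ∀ v S → E v S ≡ E′ v S
    coverCostFunction-unique v S = x∙y⁻¹≈ε⇒x≈y (E v S) (E′ v S) (D-zero S v)

module CoverCostSolution where

  open RationalArithmetic
  open HarmonicFunctions using (degree)
  open SubsetLemmas using (lookup-⁅⁆-self; lookup-⁅⁆-other)
  open import Algebra.Bundles using (CommutativeRing)
  open import Data.Bool using (true; false; not; _∨_; _∧_)
  open import Data.Bool.Properties using (∨-identityʳ; ∨-zeroʳ)
  open import Data.Empty using (⊥-elim)
  open import Data.Fin using (Fin; _≟_)
  open import Data.Fin.Subset using (Subset; ⊤; ⁅_⁆; _∪_; _∩_; ∁; ∣_∣)
  open import Data.Fin.Subset.Properties using (∣⁅x⁆∣≡1)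
  open import Data.List using (map)
  open import Data.List.Properties using (map-cong)
  open import Data.Nat using (ℕ; suc)
  open import Data.Product using (_,_)
  open import Data.Rational hiding (∣_∣; _≟_)
  open import Data.Rational.Properties hiding (_≟_)
  open import Data.Rational.Solver using (module +-*-Solver)
  open import Data.Vec using (lookup)
  open import Data.Vec.Properties using (lookup-zipWith; lookup-map; lookup-replicate)
  open import Function using (_∘_)
  open import Relation.Binary.PropositionalEquality
  open import Relation.Nullary using (yes; no)
  open +-*-Solver
  open import Algebra.Properties.Semiring.Sum (CommutativeRing.semiring +-*-commutativeRing)
    using (sum-syntax; ∑-distrib-+; sum-cong-≗; sum-replicate-zero)
    renaming (sum to ∑)
  open import Algebra.Properties.Group +-0-group using (∙-cancelˡ)

  module FromHittingTimes {m} (G : Graph (suc (suc m))) (hit : Fin (suc (suc m)) → Fin (suc (suc m)) → ℚ) (ret : Fin (suc (suc m)) → ℚ)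
           (hit-diag : ∀ v → hit v v ≡ 0ℚ)
           (hit-firstStep : ∀ v u → u ≢ v → degree G v * hit v u ≡ degree G v + sumℚ (map (λ w → hit w u) (G v)))
           (ret-firstStep : ∀ v → degree G v * ret v ≡ degree G v + sumℚ (map (λ w → hit w v) (G v))) where

    private
      N : ℕ
      N = suc (suc m)
      V : Set
      V = Fin N

    -- expected time until u is first visited at a time ≥ 1
    visit : V → V → ℚ
    visit v u with v ≟ u
    ... | yes _ = ret v
    ... | no  _ = hit v u

    visit-off : ∀ {v u} → v ≢ u → visit v u ≡ hit v u
    visit-off {v} {u} v≢u with v ≟ u
    ... | yes v≡u = ⊥-elim (v≢u v≡u)
    ... | no  _   = refl

    visit-firstStep : ∀ v u → degree G v * visit v u ≡ degree G v + sumℚ (map (λ w → hit w u) (G v))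
    visit-firstStep v u with v ≟ u
    ... | yes v≡u = subst (λ x → degree G v * ret v ≡ degree G v + sumℚ (map (λ w → hit w x) (G v))) v≡u (ret-firstStep v)
    ... | no  v≢u = hit-firstStep v u (v≢u ∘ sym)

    pending : V → Subset N → V → ℚ
    pending r S u = indicator (not (lookup S u ∨ lookup ⁅ r ⁆ u))

    -- A step costs (#vertices ≠ r not yet visited) / n, so the remaining cost is (1/n) times
    -- the sum, over those vertices, of the times until they are first visited.
    remaining : V → V → Subset N → ℚ
    remaining r v S = invSuc m * ∑[ u < N ] (pending r S u * visit v u)

    ∑-pending : ∀ r S → ∑[ u < N ] pending r S u + ℕtoℚ ∣ S ∩ ∁ ⁅ r ⁆ ∣ ≡ ℕtoℚ (suc m)
    ∑-pending r S = ∙-cancelˡ 1ℚ _ _ (begin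
      1ℚ + (P + K)                                ≡⟨ solve 2 (λ P K → con 1ℚ :+ (P :+ K) := K :+ (P :+ con 1ℚ)) refl P K ⟩
      K + (P + 1ℚ)                                ≡⟨ cong₂ (λ x y → x + (P + y)) (sym (∑-indicator (S ∩ ∁ ⁅ r ⁆)))
                                                           (sym (trans (∑-indicator ⁅ r ⁆) (cong ℕtoℚ (∣⁅x⁆∣≡1 r)))) ⟩
      ∑ (ind (S ∩ ∁ ⁅ r ⁆)) + (P + ∑ (ind ⁅ r ⁆))
                                                  ≡⟨ cong (∑ (ind (S ∩ ∁ ⁅ r ⁆)) +_) (sym (∑-distrib-+ (pending r S) (ind ⁅ r ⁆))) ⟩
      ∑ (ind (S ∩ ∁ ⁅ r ⁆)) + ∑[ u < N ] (pending r S u + ind ⁅ r ⁆ u)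
                                                  ≡⟨ sym (∑-distrib-+ (ind (S ∩ ∁ ⁅ r ⁆)) (λ u → pending r S u + ind ⁅ r ⁆ u)) ⟩
      ∑[ u < N ] (ind (S ∩ ∁ ⁅ r ⁆) u + (pending r S u + ind ⁅ r ⁆ u))
                                                  ≡⟨ sum-cong-≗ partition ⟩
      ∑[ u < N ] 1ℚ                               ≡⟨ ∑-one N ⟩
      ℕtoℚ N                                      ≡⟨ ℕtoℚ-suc (suc m) ⟩
      1ℚ + ℕtoℚ (suc m)                           ∎)
      where
      open ≡-Reasoning
      ind : Subset N → V → ℚ
      ind p u = indicator (lookup p u)
      P = ∑[ u < N ] pending r S u
      K = ℕtoℚ ∣ S ∩ ∁ ⁅ r ⁆ ∣
      partition : ∀ u → ind (S ∩ ∁ ⁅ r ⁆) u + (pending r S u + ind ⁅ r ⁆ u) ≡ 1ℚ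
      partition u rewrite lookup-zipWith _∧_ u S (∁ ⁅ r ⁆) | lookup-map u not ⁅ r ⁆
        with lookup S u | lookup ⁅ r ⁆ u
      ... | true  | true  = refl
      ... | true  | false = refl
      ... | false | true  = refl
      ... | false | false = refl

    stepCost-pending : ∀ r S → stepCost r S ≡ invSuc m * ∑[ u < N ] pending r S u
    stepCost-pending r S = begin
      1ℚ - ratio ∣ S ∩ ∁ ⁅ r ⁆ ∣ (suc m)
        ≡⟨ cong₂ (λ x y → x - y) (sym (ℕtoℚ-*-invSuc m)) (ratio-invSuc ∣ S ∩ ∁ ⁅ r ⁆ ∣ m) ⟩
      ℕtoℚ (suc m) * i - K * i                   ≡⟨ cong (λ x → x * i - K * i) (sym (∑-pending r S)) ⟩
      (P + K) * i - K * i                        ≡⟨ solve 3 (λ P K i → (P :+ K) :* i :- K :* i := i :* P) refl P K i ⟩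
      i * P                                      ∎
      where
      open ≡-Reasoning
      i = invSuc m
      P = ∑[ u < N ] pending r S u
      K = ℕtoℚ ∣ S ∩ ∁ ⁅ r ⁆ ∣

    pending-∪-visit : ∀ r S w u → pending r (S ∪ ⁅ w ⁆) u * visit w u ≡ pending r S u * hit w u
    pending-∪-visit r S w u with u ≟ w
    ... | yes refl = begin
      pending r (S ∪ ⁅ u ⁆) u * visit u u ≡⟨ cong (λ b → indicator (not (b ∨ lookup ⁅ r ⁆ u)) * visit u u) u∈S∪u ⟩
      0ℚ * visit u u                      ≡⟨ *-zeroˡ (visit u u) ⟩
      0ℚ                                  ≡⟨ sym (*-zeroʳ (pending r S u)) ⟩
      pending r S u * 0ℚ                  ≡⟨ cong (pending r S u *_) (sym (hit-diag u)) ⟩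
      pending r S u * hit u u             ∎
      where
      open ≡-Reasoning
      u∈S∪u : lookup (S ∪ ⁅ u ⁆) u ≡ true
      u∈S∪u = trans (lookup-zipWith _∨_ u S ⁅ u ⁆) (trans (cong (lookup S u ∨_) (lookup-⁅⁆-self u)) (∨-zeroʳ (lookup S u)))
    ... | no u≢w = cong₂ (λ b x → indicator (not (b ∨ lookup ⁅ r ⁆ u)) * x) unchanged (visit-off (u≢w ∘ sym))
      where
      unchanged : lookup (S ∪ ⁅ w ⁆) u ≡ lookup S u
      unchanged = trans (lookup-zipWith _∨_ u S ⁅ w ⁆)
                        (trans (cong (lookup S u ∨_) (lookup-⁅⁆-other w u u≢w)) (∨-identityʳ (lookup S u)))

    remaining-∪ : ∀ r S w → remaining r w (S ∪ ⁅ w ⁆) ≡ invSuc m * ∑[ u < N ] (pending r S u * hit w u)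
    remaining-∪ r S w = cong (invSuc m *_) (sum-cong-≗ (pending-∪-visit r S w))

    remaining-⊤ : ∀ r v → remaining r v ⊤ ≡ 0ℚ
    remaining-⊤ r v = begin
      invSuc m * ∑[ u < N ] (pending r ⊤ u * visit v u) ≡⟨ cong (invSuc m *_) (sum-cong-≗ nothing-pending) ⟩
      invSuc m * ∑[ u < N ] 0ℚ                          ≡⟨ cong (invSuc m *_) (sum-replicate-zero N) ⟩
      invSuc m * 0ℚ                                     ≡⟨ *-zeroʳ (invSuc m) ⟩
      0ℚ                                                ∎
      where
      open ≡-Reasoning
      nothing-pending : ∀ u → pending r ⊤ u * visit v u ≡ 0ℚ
      nothing-pending u = trans (cong (λ b → indicator (not (b ∨ lookup ⁅ r ⁆ u)) * visit v u) (lookup-replicate u true))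
                                (*-zeroˡ (visit v u))

    remaining-firstStep : ∀ r v S → degree G v * remaining r v S
                          ≡ degree G v * stepCost r S + sumℚ (map (λ w → remaining r w (S ∪ ⁅ w ⁆)) (G v))
    remaining-firstStep r v S = begin
      d * (i * ∑ F)
        ≡⟨ *-exchange d i (∑ F) ⟩
      i * (d * ∑ F)
        ≡⟨ cong (i *_) (sym (∑-*ˡ d F)) ⟩
      i * ∑[ u < N ] (d * F u)
        ≡⟨ cong (i *_) (sum-cong-≗ λ u → trans (*-exchange d (p u) (visit v u)) (cong (p u *_) (visit-firstStep v u))) ⟩
      i * ∑[ u < N ] (p u * (d + H u))
        ≡⟨ cong (i *_) (sum-cong-≗ λ u → trans (*-distribˡ-+ (p u) d (H u))
                                               (cong₂ _+_ (*-comm (p u) d) (sym (sumℚ-*ˡ (p u) (λ w → hit w u) (G v))))) ⟩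
      i * ∑[ u < N ] (d * p u + sumℚ (map (λ w → Q w u) (G v)))
        ≡⟨ cong (i *_) (∑-distrib-+ (λ u → d * p u) (λ u → sumℚ (map (λ w → Q w u) (G v)))) ⟩
      i * (∑[ u < N ] (d * p u) + ∑[ u < N ] sumℚ (map (λ w → Q w u) (G v)))
        ≡⟨ cong (i *_) (cong₂ _+_ (∑-*ˡ d p) (sym (sumℚ-∑-comm Q (G v)))) ⟩
      i * (d * ∑ p + sumℚ (map (λ w → ∑ (Q w)) (G v)))
        ≡⟨ *-distribˡ-+ i (d * ∑ p) (sumℚ (map (λ w → ∑ (Q w)) (G v))) ⟩
      i * (d * ∑ p) + i * sumℚ (map (λ w → ∑ (Q w)) (G v))
        ≡⟨ cong₂ _+_ (*-exchange i d (∑ p)) (sym (sumℚ-*ˡ i (λ w → ∑ (Q w)) (G v))) ⟩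
      d * (i * ∑ p) + sumℚ (map (λ w → i * ∑ (Q w)) (G v))
        ≡⟨ cong₂ _+_ (cong (d *_) (sym (stepCost-pending r S))) (cong sumℚ (map-cong (λ w → sym (remaining-∪ r S w)) (G v))) ⟩
      d * stepCost r S + sumℚ (map (λ w → remaining r w (S ∪ ⁅ w ⁆)) (G v)) ∎
      where
      open ≡-Reasoning
      d = degree G v
      i = invSuc m
      p = pending r S
      F : V → ℚ
      F u = p u * visit v u
      Q : V → V → ℚ
      Q w u = p u * hit w u
      H : V → ℚ
      H u = sumℚ (map (λ w → hit w u) (G v))
      *-exchange : ∀ a b c → a * (b * c) ≡ b * (a * c)
      *-exchange a b c = solve 3 (λ a b c → a :* (b :* c) := b :* (a :* c)) refl a b c

    remaining-isCoverCostFunction : ∀ r → IsCoverCostFunction G r (remaining r)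
    remaining-isCoverCostFunction r = remaining-⊤ r , λ v S _ → remaining-firstStep r v S

    remaining-root : ∀ r → remaining r r ⁅ r ⁆ ≡ invSuc m * ∑[ u < N ] hit r u
    remaining-root r = cong (invSuc m *_) (sum-cong-≗ root-term)
      where
      root-term : ∀ u → pending r ⁅ r ⁆ u * visit r u ≡ hit r u
      root-term u with u ≟ r
      ... | yes refl = trans (cong (λ b → indicator (not (b ∨ b)) * visit u u) (lookup-⁅⁆-self u))
                             (trans (*-zeroˡ (visit u u)) (sym (hit-diag u)))
      ... | no u≢r = begin
        pending r ⁅ r ⁆ u * visit r u ≡⟨ cong (λ b → indicator (not (b ∨ b)) * visit r u) (lookup-⁅⁆-other r u u≢r) ⟩
        1ℚ * visit r u                ≡⟨ *-identityˡ (visit r u) ⟩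
        visit r u                     ≡⟨ visit-off (u≢r ∘ sym) ⟩
        hit r u                       ∎
        where open ≡-Reasoning

module PathGraph where

  open PathHittingTimes using (pathNeighbours)
  open HarmonicFunctions using (Connected)
  open import Data.Bool using (Bool; true; false; T; T?)
  open import Data.Bool.Properties using (if-float; T-∨)
  open import Data.Fin as Fin using (Fin; toℕ; inject₁)
  open import Data.Fin.Properties using (toℕ≤pred[n]; toℕ-inject₁)
  open import Data.List using ([]; _∷_; map; applyUpTo; upTo; filterᵇ; tabulate; allFin)
  open import Data.List.Membership.Propositional using (_∈_)
  open import Data.List.Membership.Propositional.Properties using (∈-filter⁺; ∈-allFin)
  open import Data.List.Properties using (map-upTo; map-tabulate; filter-none)
  open import Data.List.Relation.Unary.All.Properties using (applyUpTo⁺₂)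
  open import Data.Nat
  open import Data.Nat.Properties
  open import Data.Product using (∃-syntax; _,_)
  open import Data.Sum using (inj₁; inj₂)
  open import Function using (_∘_; id)
  open import Function.Bundles using (Equivalence)
  open import Relation.Binary.PropositionalEquality

  filterᵇ-map : ∀ {A B : Set} (p : B → Bool) (f : A → B) xs → filterᵇ p (map f xs) ≡ map f (filterᵇ (p ∘ f) xs)
  filterᵇ-map p f []       = refl
  filterᵇ-map p f (x ∷ xs) with p (f x)
  ... | true  = cong (f x ∷_) (filterᵇ-map p f xs)
  ... | false = filterᵇ-map p f xs

  tabulate-toℕ : ∀ {A : Set} n (f : ℕ → A) → tabulate {n = n} (f ∘ toℕ) ≡ applyUpTo f n
  tabulate-toℕ zero    f = refl
  tabulate-toℕ (suc n) f = cong (f 0 ∷_) (tabulate-toℕ n (f ∘ suc))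

  map-toℕ-allFin : ∀ n → map toℕ (allFin n) ≡ upTo n
  map-toℕ-allFin n = trans (map-tabulate id toℕ) (tabulate-toℕ n id)

  filterᵇ-adjᵇ-suc : ∀ t k → filterᵇ (adjᵇ (suc t)) (applyUpTo suc k) ≡ map suc (filterᵇ (adjᵇ t) (upTo k))
  filterᵇ-adjᵇ-suc t k = trans (cong (filterᵇ (adjᵇ (suc t))) (sym (map-upTo suc k))) (filterᵇ-map (adjᵇ (suc t)) suc (upTo k))

  filterᵇ-adjᵇ-upTo : ∀ m t → t ≤ suc m → filterᵇ (adjᵇ t) (upTo (suc (suc m))) ≡ pathNeighbours (suc m) t
  filterᵇ-adjᵇ-upTo m zero _ = cong (1 ∷_) (filter-none (T? ∘ adjᵇ 0) (applyUpTo⁺₂ (suc ∘ suc) m (λ _ ())))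
  filterᵇ-adjᵇ-upTo zero (suc zero) _ = refl
  filterᵇ-adjᵇ-upTo zero (suc (suc a)) (s≤s ())
  filterᵇ-adjᵇ-upTo (suc m) (suc zero) _ =
    cong (0 ∷_) (trans (filterᵇ-adjᵇ-suc 0 (suc (suc m))) (cong (map suc) (filterᵇ-adjᵇ-upTo m zero z≤n)))
  filterᵇ-adjᵇ-upTo (suc m) (suc (suc a)) t≤n = begin
    filterᵇ (adjᵇ (suc (suc a))) (applyUpTo suc (suc (suc m))) ≡⟨ filterᵇ-adjᵇ-suc (suc a) (suc (suc m)) ⟩
    map suc (filterᵇ (adjᵇ (suc a)) (upTo (suc (suc m))))        ≡⟨ cong (map suc) (filterᵇ-adjᵇ-upTo m (suc a) (s≤s⁻¹ t≤n)) ⟩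
    map suc (pathNeighbours (suc m) (suc a))                      ≡⟨ if-float (map suc) (suc a ≡ᵇ suc m) ⟩
    pathNeighbours (suc (suc m)) (suc (suc a))                    ∎
    where open ≡-Reasoning

  Path-neighbours : ∀ m (v : Fin (suc (suc m))) → map toℕ (Path (suc m) v) ≡ pathNeighbours (suc m) (toℕ v)
  Path-neighbours m v = begin
    map toℕ (filterᵇ (adjᵇ (toℕ v) ∘ toℕ) (allFin _)) ≡⟨ sym (filterᵇ-map (adjᵇ (toℕ v)) toℕ (allFin _)) ⟩
    filterᵇ (adjᵇ (toℕ v)) (map toℕ (allFin _))       ≡⟨ cong (filterᵇ (adjᵇ (toℕ v))) (map-toℕ-allFin _) ⟩
    filterᵇ (adjᵇ (toℕ v)) (upTo _)                   ≡⟨ filterᵇ-adjᵇ-upTo m (toℕ v) (toℕ≤pred[n] v) ⟩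
    pathNeighbours (suc m) (toℕ v)                    ∎
    where open ≡-Reasoning

  adjᵇ-suc : ∀ t → T (adjᵇ t (suc t))
  adjᵇ-suc t = Equivalence.from T-∨ (inj₂ (≡⇒≡ᵇ (suc t) (suc t) refl))

  adjᵇ-pred : ∀ t → T (adjᵇ (suc t) t)
  adjᵇ-pred t = Equivalence.from T-∨ (inj₁ (≡⇒≡ᵇ (suc t) (suc t) refl))

  Path-edge-up : ∀ {n} (i : Fin n) → Fin.suc i ∈ Path n (inject₁ i)
  Path-edge-up i = ∈-filter⁺ (T? ∘ λ j → adjᵇ (toℕ (inject₁ i)) (toℕ j)) (∈-allFin (Fin.suc i))
                     (subst (λ t → T (adjᵇ t (suc (toℕ i)))) (sym (toℕ-inject₁ i)) (adjᵇ-suc (toℕ i)))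

  Path-edge-down : ∀ {n} (i : Fin n) → inject₁ i ∈ Path n (Fin.suc i)
  Path-edge-down i = ∈-filter⁺ (T? ∘ λ j → adjᵇ (suc (toℕ i)) (toℕ j)) (∈-allFin (inject₁ i))
                       (subst (λ t → T (adjᵇ (suc (toℕ i)) t)) (sym (toℕ-inject₁ i)) (adjᵇ-pred (toℕ i)))

  Path-connected : ∀ n → Connected (Path n)
  Path-connected n P closed {v} {w} Pv = from-zero (toℕ w) w refl (to-zero (toℕ v) v refl Pv)
    where
    to-zero : ∀ k v → toℕ v ≡ k → P v → P Fin.zero
    to-zero _       Fin.zero _  p = p
    to-zero (suc k) (Fin.suc i) eq p = to-zero k (inject₁ i) (trans (toℕ-inject₁ i) (suc-injective eq)) (closed (Path-edge-down i) p)

    from-zero : ∀ k v → toℕ v ≡ k → P Fin.zero → P v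
    from-zero _       Fin.zero _  p = p
    from-zero (suc k) (Fin.suc i) eq p = closed (Path-edge-up i) (from-zero k (inject₁ i) (trans (toℕ-inject₁ i) (suc-injective eq)) p)

  Path-neighbour : ∀ {m} (v : Fin (suc (suc m))) → ∃[ w ] w ∈ Path (suc m) v
  Path-neighbour Fin.zero    = Fin.suc Fin.zero , Path-edge-up Fin.zero
  Path-neighbour (Fin.suc i) = inject₁ i , Path-edge-down i


module PathCoverCost where

  open PathHittingTimes
  open PathGraph using (Path-neighbours; Path-connected; Path-neighbour)
  open RationalArithmetic
  open HarmonicFunctions using (degree)
  open CoverCostUniqueness using (coverCostFunction-unique)
  open import Data.Fin using (Fin; toℕ)
  open import Data.Fin.Properties using (toℕ≤pred[n]; toℕ-injective)
  open import Data.Fin.Subset using (⁅_⁆)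
  open import Data.List using (map; length)
  open import Data.List.Properties using (length-map; map-∘)
  open import Data.Nat as ℕ using (ℕ; suc; s≤s; z≤n)
  open import Data.Nat.ListAction using (sum)
  import Data.Nat.Properties as ℕ
  open import Data.Product using (_,_)
  open import Data.Rational using (ℚ; 0ℚ; _+_; _*_; _≤_)
  open import Data.Rational.Properties using (*-monoˡ-≤-nonNeg)
  open import Function using (_∘_)
  open import Relation.Binary.PropositionalEquality

  module _ (m : ℕ) where

    private
      n : ℕ
      n = suc m

    hitℚ : Fin (suc n) → Fin (suc n) → ℚ
    hitℚ v u = ℕtoℚ (hitting n (toℕ v) (toℕ u))

    retℚ : Fin (suc n) → ℚ
    retℚ v = ℕtoℚ (returnTime n (toℕ v))

    FirstStep-ℚ : ∀ v u x → FirstStep n (toℕ v) (toℕ u) x →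
                  degree (Path n) v * ℕtoℚ x ≡ degree (Path n) v + sumℚ (map (λ w → hitℚ w u) (Path n v))
    FirstStep-ℚ v u x firstStep = begin
      ℕtoℚ (length (Path n v)) * ℕtoℚ x    ≡⟨ cong (λ k → ℕtoℚ k * ℕtoℚ x) degree≡ ⟩
      ℕtoℚ (length ns) * ℕtoℚ x            ≡⟨ sym (ℕtoℚ-* (length ns) x) ⟩
      ℕtoℚ (length ns ℕ.* x)               ≡⟨ cong ℕtoℚ firstStep ⟩
      ℕtoℚ (length ns ℕ.+ sum (map h ns))  ≡⟨ ℕtoℚ-+ (length ns) (sum (map h ns)) ⟩
      ℕtoℚ (length ns) + ℕtoℚ (sum (map h ns))
        ≡⟨ cong₂ (λ k s → ℕtoℚ k + s) (sym degree≡) sums ⟩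
      ℕtoℚ (length (Path n v)) + sumℚ (map (λ w → hitℚ w u) (Path n v)) ∎
      where
      open ≡-Reasoning
      ns = pathNeighbours n (toℕ v)
      h : ℕ → ℕ
      h j = hitting n j (toℕ u)
      degree≡ : length (Path n v) ≡ length ns
      degree≡ = trans (sym (length-map toℕ (Path n v))) (cong length (Path-neighbours m v))
      sums : ℕtoℚ (sum (map h ns)) ≡ sumℚ (map (λ w → hitℚ w u) (Path n v))
      sums = begin
        ℕtoℚ (sum (map h ns))                  ≡⟨ cong (ℕtoℚ ∘ sum ∘ map h) (sym (Path-neighbours m v)) ⟩
        ℕtoℚ (sum (map h (map toℕ (Path n v)))) ≡⟨ cong (ℕtoℚ ∘ sum) (sym (map-∘ (Path n v))) ⟩
        ℕtoℚ (sum (map (h ∘ toℕ) (Path n v)))  ≡⟨ ℕtoℚ-sum (h ∘ toℕ) (Path n v) ⟩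
        sumℚ (map (λ w → hitℚ w u) (Path n v)) ∎

    hitℚ-diag : ∀ v → hitℚ v v ≡ 0ℚ
    hitℚ-diag v = cong ℕtoℚ (hitting-up n (toℕ v) (toℕ v) 0 (sym (ℕ.+-identityʳ (toℕ v))))

    hitℚ-firstStep : ∀ v u → u ≢ v →
                     degree (Path n) v * hitℚ v u ≡ degree (Path n) v + sumℚ (map (λ w → hitℚ w u) (Path n v))
    hitℚ-firstStep v u u≢v = FirstStep-ℚ v u _
      (hitting-firstStep n (toℕ v) (toℕ u) (toℕ≤pred[n] v) (toℕ≤pred[n] u) (u≢v ∘ toℕ-injective))

    retℚ-firstStep : ∀ v → degree (Path n) v * retℚ v ≡ degree (Path n) v + sumℚ (map (λ w → hitℚ w v) (Path n v))
    retℚ-firstStep v = FirstStep-ℚ v v _ (returnTime-firstStep n (toℕ v) (s≤s z≤n) (toℕ≤pred[n] v))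

    coverCost : Fin (suc n) → ℚ
    coverCost r = invSuc m * ℕtoℚ (totalHitting n (toℕ r))

    open CoverCostSolution.FromHittingTimes (Path n) hitℚ retℚ hitℚ-diag hitℚ-firstStep retℚ-firstStep

    remaining-root≡coverCost : ∀ r → remaining r r ⁅ r ⁆ ≡ coverCost r
    remaining-root≡coverCost r =
      trans (remaining-root r)
            (cong (invSuc m *_) (∑-ℕtoℚ (suc n) (hitting n (toℕ r))))

    coverCost-isCoverCost : ∀ r → IsCoverCost (Path n) r (coverCost r)
    coverCost-isCoverCost r =
      remaining r , remaining-isCoverCostFunction r , remaining-root≡coverCost r

    isCoverCost⇒≡coverCost : ∀ {r c} → IsCoverCost (Path n) r c → c ≡ coverCost r
    isCoverCost⇒≡coverCost {r} {c} (E , isE , E≡c) = begin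
      c                    ≡⟨ sym E≡c ⟩
      E r ⁅ r ⁆            ≡⟨ coverCostFunction-unique (Path-connected n) Path-neighbour isE
                               (remaining-isCoverCostFunction r) r ⁅ r ⁆ ⟩
      remaining r r ⁅ r ⁆ ≡⟨ remaining-root≡coverCost r ⟩
      coverCost r          ∎
      where open ≡-Reasoning

    coverCost-mono : ∀ r s → totalHitting n (toℕ r) ℕ.≤ totalHitting n (toℕ s) → coverCost r ≤ coverCost s
    coverCost-mono _ _ le = *-monoˡ-≤-nonNeg (invSuc m) (ℕtoℚ-mono-≤ le)

module PathCoverCostExtremes (h′ : ℕ) where

  open PathHittingTimes
  open PathCoverCost
  open RationalArithmetic
  open import Data.Fin using (toℕ)
  open import Data.Fin.Properties using (toℕ≤pred[n]; toℕ-fromℕ; toℕ-fromℕ<)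
  open import Data.Integer using (+_)
  open import Data.Nat as ℕ using (ℕ; suc)
  import Data.Nat.Properties as ℕ
  open import Data.Rational using (_/_; _+_; _-_; _*_; _≤_)
  open import Data.Rational.Solver using (module +-*-Solver)
  open import Relation.Binary.PropositionalEquality
  open +-*-Solver

  private
    h m : ℕ
    h = suc h′
    m = h′ ℕ.+ suc h′

  toℕ-vmid : toℕ (vmid h) ≡ h
  toℕ-vmid = toℕ-fromℕ< (ℕ.s≤s (ℕ.m≤m+n h h))

  coverCost-v0-min : ∀ r → coverCost m (v0 h) ≤ coverCost m r
  coverCost-v0-min r = coverCost-mono m (v0 h) r (totalHitting-min (h ℕ.+ h) (toℕ r) (toℕ≤pred[n] r))

  coverCost-vend≡v0 : coverCost m (vend h) ≡ coverCost m (v0 h)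
  coverCost-vend≡v0 = cong (λ t → invSuc m * ℕtoℚ t)
    (trans (cong (totalHitting (h ℕ.+ h)) (toℕ-fromℕ (h ℕ.+ h))) (totalHitting-last (h ℕ.+ h)))

  coverCost-vend-min : ∀ r → coverCost m (vend h) ≤ coverCost m r
  coverCost-vend-min r = subst (_≤ coverCost m r) (sym coverCost-vend≡v0) (coverCost-v0-min r)

  coverCost-vmid-max : ∀ r → coverCost m r ≤ coverCost m (vmid h)
  coverCost-vmid-max r = coverCost-mono m r (vmid h)
    (subst (λ t → totalHitting (h ℕ.+ h) (toℕ r) ℕ.≤ totalHitting (h ℕ.+ h) t) (sym toℕ-vmid)
           (totalHitting-max h (toℕ r) (toℕ≤pred[n] r)))

  coverCost-vmid-v0 : coverCost m (vmid h) - coverCost m (v0 h) ≡ + (h ℕ.+ h) / 4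
  coverCost-vmid-v0 = begin
    i * ℕtoℚ (totalHitting (h ℕ.+ h) (toℕ (vmid h))) - i * T₀
      ≡⟨ cong (λ t → i * ℕtoℚ t - i * T₀) (trans (cong (totalHitting (h ℕ.+ h)) toℕ-vmid) (totalHitting-middle h)) ⟩
    i * ℕtoℚ (totalHitting (h ℕ.+ h) 0 ℕ.+ h ℕ.* h) - i * T₀
      ≡⟨ cong (λ t → i * t - i * T₀) (ℕtoℚ-+ (totalHitting (h ℕ.+ h) 0) (h ℕ.* h)) ⟩
    i * (T₀ + ℕtoℚ (h ℕ.* h)) - i * T₀
      ≡⟨ solve 3 (λ i t s → i :* (t :+ s) :- i :* t := i :* s) refl i T₀ (ℕtoℚ (h ℕ.* h)) ⟩
    i * ℕtoℚ (h ℕ.* h)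
      ≡⟨ invSuc-*-square m h refl ⟩
    + (h ℕ.+ h) / 4 ∎
    where
    open ≡-Reasoning
    i = invSuc m
    T₀ = ℕtoℚ (totalHitting (h ℕ.+ h) 0)

open import Data.Nat using (ℕ; suc; _≤_)
open import Data.Fin using (Fin)
open import Data.Rational using (ℚ; _-_; _/_) renaming (_≤_ to _≤ℚ_)
open import Data.Integer using (+_)
open import Data.Product using (Σ; _×_; _,_)
open import Relation.Binary.PropositionalEquality using (_≡_; sym; trans; cong₂; subst₂)
open PathCoverCost using (coverCost; coverCost-isCoverCost; isCoverCost⇒≡coverCost)

theorem2 : (h : ℕ) → 1 ≤ h →
    (Σ (Fin _ → ℚ) λ cc → ∀ r → IsCoverCost (Path (h Data.Nat.+ h)) r (cc r)) ×
    ((cc : Fin _ → ℚ) → (∀ r → IsCoverCost (Path (h Data.Nat.+ h)) r (cc r)) →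
      ((∀ r → (cc (v0 h) ≤ℚ cc r) × (cc (vend h) ≤ℚ cc r) × (cc r ≤ℚ cc (vmid h))) ×
       (cc (vmid h) - cc (v0 h) ≡ + (h Data.Nat.+ h) / 4)))
theorem2 (suc h′) _ = (coverCost m , coverCost-isCoverCost m) , λ cc isCC →
  let cc≡ : ∀ r → cc r ≡ coverCost m r
      cc≡ r = isCoverCost⇒≡coverCost m (isCC r)
  in (λ r → subst₂ _≤ℚ_ (sym (cc≡ (v0 h))) (sym (cc≡ r)) (coverCost-v0-min r) ,
            subst₂ _≤ℚ_ (sym (cc≡ (vend h))) (sym (cc≡ r)) (coverCost-vend-min r) ,
            subst₂ _≤ℚ_ (sym (cc≡ r)) (sym (cc≡ (vmid h))) (coverCost-vmid-max r)) ,
     trans (cong₂ _-_ (cc≡ (vmid h)) (cc≡ (v0 h))) coverCost-vmid-v0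
  where
  open PathCoverCostExtremes h′
  h m : ℕ
  h = suc h′
  m = h′ Data.Nat.+ suc h′
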